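{- Let $n\ge 0$ be an integer. For a partition $\lambda: n=a_1+a_2+\dots+a_k$ with $a_1\ge a_2\ge\dots\ge a_k\ge 1$, let $|\lambda_e|=a_2+a_4+a_6+\cdots$ be the sum of its parts of even index. Let $f(n,j)$ denote the number of partitions $\lambda$ of $n$ with $|\lambda_e|=j$, and let $p(\cdot)$ denote the ordinary partition function (with $p(0)=1$). Then for every integer $j$ with $0\le j\le n/3$, $$f(n,j)=\sum_{i=0}^{j} p(i)\,p(j-i),$$ and this bound on $j$ is best possible: for every integer $j$ with $j>n/3$ one has $f(n,j)<\sum_{i=0}^{j}p(i)\,p(j-i)$.
   Context: The quantity $\sum_{i=0}^{j}p(i)p(j-i)$ counts ordered pairs $(\alpha,\beta)$ of integer partitions with $|\alpha|+|\beta|=j$. -}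

module Defs where

open import Data.Nat using (ℕ; zero; suc; _+_; _*_; _∸_; _≤_; _≥_; _≟_; _≥?_; _≤?_)
open import Data.List using (List; []; _∷_; map; length; filter; upTo; concatMap)
open import Data.Nat.ListAction using (sum)
open import Data.List.Relation.Unary.All using (All; all?)
open import Data.List.Relation.Unary.Linked using (Linked; linked?)
open import Data.Product using (_×_)
open import Relation.Nullary.Decidable using (Dec; _×-dec_)
open import Relation.Binary.PropositionalEquality using (_≡_)

IsPartition : ℕ → List ℕ → Set
IsPartition n l = (sum l ≡ n) × (All (1 ≤_) l × Linked _≥_ l)

isPartition? : (n : ℕ) → (l : List ℕ) → Dec (IsPartition n l)
isPartition? n l = (sum l ≟ n) ×-dec (all? (1 ≤?_) l ×-dec linked? _≥?_ l)

evenSum : List ℕ → ℕ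
evenSum []            = 0
evenSum (a ∷ [])      = 0
evenSum (a ∷ b ∷ rest) = b + evenSum rest

listsOf : ℕ → ℕ → List (List ℕ)
listsOf zero    m = [] ∷ []
listsOf (suc k) m = concatMap (λ a → map (a ∷_) (listsOf k m)) (upTo (suc m))

-- Candidate lists for partitions of n: length ≤ n, entries ≤ n
-- (every partition of n is among them, each list exactly once).
candidates : ℕ → List (List ℕ)
candidates n = concatMap (λ k → listsOf k n) (upTo (suc n))

partitions : ℕ → List (List ℕ)
partitions n = filter (isPartition? n) (candidates n)

p : ℕ → ℕ
p n = length (partitions n)

f : ℕ → ℕ → ℕ
f n j = length (filter (λ l → evenSum l ≟ j) (partitions n))

conv : ℕ → ℕ
conv j = sum (map (λ i → p i * p (j ∸ i)) (upTo (suc j)))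

{-# OPTIONS --safe #-}
-- A partition a₁ ≥ a₂ ≥ … is determined by its consecutive differences. Recording a₂ᵢ − a₂ᵢ₊₁ and
-- a₂ᵢ₊₁ − a₂ᵢ₊₂ (i ≥ 1) as the multiplicities of the part i in two partitions α and β gives a bijection
-- λ ↦ (α, β, a₁ − a₂) onto all triples, with |α| + |β| = |λ_e| and |λ| = 2|λ_e| + ℓ(β) + (a₁ − a₂).
-- So f(n, j) counts the pairs (α, β) with |α| + |β| = j and 2j + ℓ(β) ≤ n. As ℓ(β) ≤ |β| ≤ j, every
-- pair qualifies when 3j ≤ n, whereas for n < 3j the pair (∅, 1ʲ) does not.
module Submission where

open import Defs
open import Data.Nat using (ℕ; zero; suc; pred; _≥_; _+_; _*_; _∸_; _≤_; _<_; _≤?_; _≟_; z≤n; s≤s; s≤s⁻¹)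
open import Data.Nat.Properties
open import Data.Nat.ListAction using (sum)
open import Data.Nat.Tactic.RingSolver using (solve-∀)
open import Data.List using (List; []; _∷_; map; length; filter; upTo; concatMap; cartesianProduct; _++_; replicate)
open import Data.List.Properties
  using (length-++; length-map; length-replicate; map-cong; ∷-injective; ∷-injectiveʳ; filter-all; filter-notAll)
open import Data.List.Relation.Unary.All as All using (All; []; _∷_)
open import Data.List.Relation.Unary.All.Properties as All using ()
open import Data.List.Relation.Unary.AllPairs as AllPairs using ([]; _∷_)
open import Data.List.Relation.Unary.AllPairs.Properties as AllPairs using ()
open import Data.List.Relation.Unary.Any using (here; there)
open import Data.List.Relation.Unary.Linked as Linked using (Linked; []; [-]; _∷_)
open import Data.List.Relation.Unary.Unique.Propositional using (Unique)
open import Data.List.Relation.Unary.Unique.Propositional.Properties using (concat⁺; cartesianProduct⁺; map⁺; upTo⁺; filter⁺)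
open import Data.List.Membership.Propositional using (_∈_; lose; find)
open import Data.List.Membership.Propositional.Properties
  using (∈-map⁺; ∈-map⁻; ∈-concatMap⁺; ∈-concatMap⁻; ∈-cartesianProduct⁺; ∈-cartesianProduct⁻; ∈-upTo⁺; ∈-upTo⁻; ∈-filter⁺; ∈-filter⁻)
open import Data.List.Membership.Propositional.Properties.WithK using (unique∧set⇒bag)
open import Data.List.Relation.Binary.BagAndSetEquality using (_∼[_]_; set; ∼bag⇒↭)
open import Data.List.Relation.Binary.Permutation.Propositional.Properties using (↭-length)
open import Data.Product using (_×_; _,_; proj₁; proj₂; ∃-syntax)
open import Data.Empty using (⊥-elim)
open import Function using (_∘_; mk⇔)
open import Relation.Nullary using (¬_; contradiction)
open import Relation.Unary using (Decidable)
open import Algebra.Properties.CommutativeSemigroup +-commutativeSemigroup using () renaming (interchange to +-interchange)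
open import Relation.Binary.PropositionalEquality
  using (_≡_; _≢_; refl; sym; trans; cong; cong₂; subst; subst₂; module ≡-Reasoning)

module _ {A B : Set} where

  length-concatMap : (f : A → List B) (xs : List A) → length (concatMap f xs) ≡ sum (map (length ∘ f) xs)
  length-concatMap f []       = refl
  length-concatMap f (x ∷ xs) = trans (length-++ (f x)) (cong (length (f x) +_) (length-concatMap f xs))

  length-cartesianProduct : (xs : List A) (ys : List B) → length (cartesianProduct xs ys) ≡ length xs * length ys
  length-cartesianProduct []       ys = refl
  length-cartesianProduct (x ∷ xs) ys =
    trans (length-++ (map (x ,_) ys)) (cong₂ _+_ (length-map (x ,_) ys) (length-cartesianProduct xs ys))

  ∈-concatMap⁺′ : (f : A → List B) {xs : List A} {x : A} {y : B} → x ∈ xs → y ∈ f x → y ∈ concatMap f xs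
  ∈-concatMap⁺′ f x∈xs y∈fx = ∈-concatMap⁺ f (lose x∈xs y∈fx)

  ∈-concatMap⁻′ : (f : A → List B) (xs : List A) {y : B} → y ∈ concatMap f xs → ∃[ x ] x ∈ xs × y ∈ f x
  ∈-concatMap⁻′ f xs y∈ = find (∈-concatMap⁻ f y∈)

  concatMap-unique : (f : A → List B) {xs : List A} → Unique xs → (∀ x → Unique (f x)) →
                     (∀ {x x′ y} → y ∈ f x → y ∈ f x′ → x ≡ x′) → Unique (concatMap f xs)
  concatMap-unique f xs! f! separated =
    concat⁺ (All.map⁺ (All.tabulate λ {x} _ → f! x))
            (AllPairs.map⁺ {f = f} (AllPairs.map (λ x≢x′ {_} (y∈ , y∈′) → x≢x′ (separated y∈ y∈′)) xs!))

  map-unique : (f : A → B) {xs : List A} → (∀ {x x′} → x ∈ xs → x′ ∈ xs → f x ≡ f x′ → x ≡ x′) →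
               Unique xs → Unique (map f xs)
  map-unique f inj []           = []
  map-unique f inj (x∉ ∷ xs!) =
    All.map⁺ (All.tabulate λ x′∈ fx≡fx′ → All.lookup x∉ x′∈ (inj (here refl) (there x′∈) fx≡fx′))
    ∷ map-unique f (λ p q → inj (there p) (there q)) xs!

length-unique-set : {A : Set} {xs ys : List A} → Unique xs → Unique ys → xs ∼[ set ] ys → length xs ≡ length ys
length-unique-set xs! ys! xs≈ys = ↭-length (∼bag⇒↭ (unique∧set⇒bag xs! ys! xs≈ys))

Partition : List ℕ → Set
Partition l = All (1 ≤_) l × Linked _≥_ l

largestPart : List ℕ → ℕ
largestPart []      = 0
largestPart (a ∷ _) = a

secondPart : List ℕ → ℕ
secondPart (_ ∷ b ∷ _) = b
secondPart _           = 0

largestPart-tail≤ : ∀ {a l} → Linked _≥_ (a ∷ l) → largestPart l ≤ a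
largestPart-tail≤ [-]       = z≤n
largestPart-tail≤ (a≥b ∷ _) = a≥b

linked-∷ : ∀ {a l} → largestPart l ≤ a → Linked _≥_ l → Linked _≥_ (a ∷ l)
linked-∷ {l = []}    _   _  = [-]
linked-∷ {l = _ ∷ _} a≥b lk = a≥b ∷ lk

length≤sum : ∀ {l} → All (1 ≤_) l → length l ≤ sum l
length≤sum []         = z≤n
length≤sum (1≤a ∷ ps) = +-mono-≤ 1≤a (length≤sum ps)

parts≤sum : ∀ l → All (_≤ sum l) l
parts≤sum []      = []
parts≤sum (a ∷ l) = m≤m+n a (sum l) ∷ All.map (λ b≤ → ≤-trans b≤ (m≤n+m (sum l) a)) (parts≤sum l)

ones : ℕ → List ℕ
ones x = replicate x 1

ones-partition : ∀ x → Partition (ones x)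
ones-partition zero          = [] , []
ones-partition (suc zero)    = s≤s z≤n ∷ [] , [-]
ones-partition (suc (suc x)) = s≤s z≤n ∷ proj₁ (ones-partition (suc x)) , ≤-refl ∷ proj₂ (ones-partition (suc x))

sum-ones : ∀ x → sum (ones x) ≡ x
sum-ones zero    = refl
sum-ones (suc x) = cong suc (sum-ones x)

ones-unique : ∀ {l} → Linked _≥_ (1 ∷ l) → All (1 ≤_) l → l ≡ ones (length l)
ones-unique {[]}              _          _        = refl
ones-unique {suc zero ∷ l}    (_ ∷ lk)   (_ ∷ ps) = cong (1 ∷_) (ones-unique lk ps)
ones-unique {suc (suc _) ∷ _} (s≤s () ∷ _) _

addColumn : List ℕ → ℕ → List ℕ
addColumn μ x = map suc μ ++ ones x

largestPart-addColumn : ∀ μ x → largestPart (addColumn μ x) ≤ suc (largestPart μ)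
largestPart-addColumn []      zero    = z≤n
largestPart-addColumn []      (suc x) = ≤-refl
largestPart-addColumn (a ∷ μ) x       = ≤-refl

addColumn-partition : ∀ {μ} x → Partition μ → Partition (addColumn μ x)
addColumn-partition {[]}    x _             = ones-partition x
addColumn-partition {a ∷ μ} x (_ ∷ ps , lk) =
  let ps′ , lk′ = addColumn-partition x (ps , Linked.tail lk)
  in s≤s z≤n ∷ ps′ , linked-∷ (≤-trans (largestPart-addColumn μ x) (s≤s (largestPart-tail≤ lk))) lk′

length-addColumn : ∀ μ x → length (addColumn μ x) ≡ length μ + x
length-addColumn μ x = trans (length-++ (map suc μ)) (cong₂ _+_ (length-map suc μ) (length-replicate x))

sum-addColumn : ∀ μ x → sum (addColumn μ x) ≡ sum μ + length (addColumn μ x)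
sum-addColumn []      x = trans (sum-ones x) (sym (length-replicate x))
sum-addColumn (a ∷ μ) x = begin
  suc a + sum (addColumn μ x)                  ≡⟨ cong (suc a +_) (sum-addColumn μ x) ⟩
  suc a + (sum μ + length (addColumn μ x))      ≡⟨ rearrange a (sum μ) (length (addColumn μ x)) ⟩
  a + sum μ + suc (length (addColumn μ x))      ∎
  where
  open ≡-Reasoning
  rearrange : ∀ a s l → suc a + (s + l) ≡ a + s + suc l
  rearrange = solve-∀

ones≢addColumn∷ : ∀ {b ν x y} → 1 ≤ b → ones x ≢ addColumn (b ∷ ν) y
ones≢addColumn∷ {x = zero}  _       ()
ones≢addColumn∷ {x = suc x} (s≤s _) ()

addColumn-injective : ∀ {μ ν x y} → All (1 ≤_) μ → All (1 ≤_) ν → addColumn μ x ≡ addColumn ν y → μ ≡ ν × x ≡ y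
addColumn-injective {[]}    {[]}    {x} {y} _ _ eq =
  refl , trans (sym (length-replicate x)) (trans (cong length eq) (length-replicate y))
addColumn-injective {[]}    {_ ∷ ν} {x} {y} _ (1≤b ∷ _) eq = ⊥-elim (ones≢addColumn∷ {ν = ν} {x} {y} 1≤b eq)
addColumn-injective {_ ∷ μ} {[]}    {x} {y} (1≤a ∷ _) _ eq = ⊥-elim (ones≢addColumn∷ {ν = μ} {y} {x} 1≤a (sym eq))
addColumn-injective {_ ∷ _} {_ ∷ _} (_ ∷ μ⁺) (_ ∷ ν⁺) eq =
  let a≡b , tails≡ = ∷-injective eq
      μ≡ν , x≡y    = addColumn-injective μ⁺ ν⁺ tails≡
  in cong₂ _∷_ (suc-injective a≡b) μ≡ν , x≡y

removeColumn : ∀ μ → Partition μ →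
               ∃[ μ′ ] ∃[ x ] Partition μ′ × largestPart μ′ ≤ pred (largestPart μ) × μ ≡ addColumn μ′ x
removeColumn []                 _              = [] , 0 , ([] , []) , z≤n , refl
removeColumn (zero ∷ μ)         (() ∷ _ , _)
removeColumn (suc zero ∷ μ)     (_ ∷ ps , lk)  = [] , suc (length μ) , ([] , []) , z≤n , cong (1 ∷_) (ones-unique lk ps)
removeColumn (suc (suc k) ∷ μ)  (_ ∷ ps , lk)
  with μ′ , x , (ps′ , lk′) , bound , refl ← removeColumn μ (ps , Linked.tail lk)
  = suc k ∷ μ′ , x , (s≤s z≤n ∷ ps′ , linked-∷ (≤-trans bound (pred-mono-≤ (largestPart-tail≤ lk))) lk′)
  , ≤-refl , refl

-- For λ = a₁ ≥ a₂ ≥ …, evenGaps λ has a₂ᵢ − a₂ᵢ₊₁ parts equal to i, oddGaps λ has a₂ᵢ₊₁ − a₂ᵢ₊₂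
-- parts equal to i (parts past the end read as 0), and topGap λ = a₁ − a₂.
evenGaps : List ℕ → List ℕ
evenGaps []          = []
evenGaps (_ ∷ [])    = []
evenGaps (_ ∷ b ∷ l) = addColumn (evenGaps l) (b ∸ largestPart l)

topGap : List ℕ → ℕ
topGap l = largestPart l ∸ secondPart l

oddGaps : List ℕ → List ℕ
oddGaps []          = []
oddGaps (_ ∷ [])    = []
oddGaps (_ ∷ _ ∷ l) = addColumn (oddGaps l) (topGap l)

gapPartitions : List ℕ → List ℕ × List ℕ
gapPartitions l = evenGaps l , oddGaps l

evenGaps-partition : ∀ l → Partition (evenGaps l)
evenGaps-partition []          = [] , []
evenGaps-partition (_ ∷ [])    = [] , []
evenGaps-partition (_ ∷ b ∷ l) = addColumn-partition (b ∸ largestPart l) (evenGaps-partition l)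

oddGaps-partition : ∀ l → Partition (oddGaps l)
oddGaps-partition []          = [] , []
oddGaps-partition (_ ∷ [])    = [] , []
oddGaps-partition (_ ∷ _ ∷ l) = addColumn-partition (topGap l) (oddGaps-partition l)

topGap+secondPart : ∀ {l} → Linked _≥_ l → topGap l + secondPart l ≡ largestPart l
topGap+secondPart []        = refl
topGap+secondPart {a ∷ []} [-] = +-identityʳ a
topGap+secondPart (a≥b ∷ _) = m∸n+n≡m a≥b

length-gaps : ∀ {l} → Linked _≥_ l → length (evenGaps l) + length (oddGaps l) ≡ secondPart l
length-gaps []  = refl
length-gaps [-] = refl
length-gaps {_ ∷ b ∷ l} (_ ∷ lk) = begin
  length (addColumn E x) + length (addColumn O t) ≡⟨ cong₂ _+_ (length-addColumn E x) (length-addColumn O t) ⟩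
  length E + x + (length O + t)                   ≡⟨ rearrange (length E) x (length O) t ⟩
  x + (t + (length E + length O))                 ≡⟨ cong (λ s → x + (t + s)) (length-gaps (Linked.tail lk)) ⟩
  x + (t + secondPart l)                          ≡⟨ cong (x +_) (topGap+secondPart (Linked.tail lk)) ⟩
  x + largestPart l                               ≡⟨ m∸n+n≡m (largestPart-tail≤ lk) ⟩
  b                                               ∎
  where
  open ≡-Reasoning
  E = evenGaps l
  O = oddGaps l
  x = b ∸ largestPart l
  t = topGap l
  rearrange : ∀ e x o t → e + x + (o + t) ≡ x + (t + (e + o))
  rearrange = solve-∀

sum-gaps : ∀ {l} → Linked _≥_ l → sum (evenGaps l) + sum (oddGaps l) ≡ evenSum l
sum-gaps []  = refl
sum-gaps [-] = refl
sum-gaps {_ ∷ b ∷ l} lk@(_ ∷ lk′) = begin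
  sum E′ + sum O′                                   ≡⟨ cong₂ _+_ (sum-addColumn E x) (sum-addColumn O t) ⟩
  sum E + length E′ + (sum O + length O′)           ≡⟨ +-interchange (sum E) (length E′) (sum O) (length O′) ⟩
  sum E + sum O + (length E′ + length O′)           ≡⟨ cong₂ _+_ (sum-gaps (Linked.tail lk′)) (length-gaps lk) ⟩
  evenSum l + b                                     ≡⟨ +-comm (evenSum l) b ⟩
  b + evenSum l                                     ∎
  where
  open ≡-Reasoning
  E = evenGaps l
  O = oddGaps l
  x = b ∸ largestPart l
  t = topGap l
  E′ = addColumn E x
  O′ = addColumn O t

-- The least size of a partition λ with |λ_e| = j and oddGaps λ = β.
minimalSize : ℕ → List ℕ → ℕ
minimalSize j β = j + (j + length β)

sum-via-gaps : ∀ {l} → Linked _≥_ l → sum l ≡ minimalSize (evenSum l) (oddGaps l) + topGap l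
sum-via-gaps []           = refl
sum-via-gaps {a ∷ []} [-] = +-identityʳ a
sum-via-gaps {a ∷ b ∷ l} (a≥b ∷ lk) = begin
  a + (b + sum l)                               ≡⟨ cong₂ (λ a′ s → a′ + (b + s)) (sym (m∸n+n≡m a≥b)) (sum-via-gaps (Linked.tail lk)) ⟩
  a ∸ b + b + (b + (e + (e + length O) + t))    ≡⟨ rearrange (a ∸ b) b e (length O) t ⟩
  b + e + (b + e + (length O + t)) + (a ∸ b)    ≡⟨ cong (λ k → b + e + (b + e + k) + (a ∸ b)) (sym (length-addColumn O t)) ⟩
  b + e + (b + e + length (addColumn O t)) + (a ∸ b) ∎
  where
  open ≡-Reasoning
  e = evenSum l
  O = oddGaps l
  t = topGap l
  rearrange : ∀ c b e o t → c + b + (b + (e + (e + o) + t)) ≡ b + e + (b + e + (o + t)) + c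
  rearrange = solve-∀

oneRow : ℕ → List ℕ
oneRow zero    = []
oneRow (suc r) = suc r ∷ []

gapless⇒oneRow : ∀ {l} → Partition l → evenGaps l ≡ [] → oddGaps l ≡ [] → l ≡ oneRow (topGap l)
gapless⇒oneRow {[]}         _            _    _    = refl
gapless⇒oneRow {zero ∷ []}  (() ∷ _ , _)
gapless⇒oneRow {suc _ ∷ []} _            _    _    = refl
gapless⇒oneRow {_ ∷ _ ∷ _}  (_ ∷ 1≤b ∷ _ , lk) E≡[] O≡[] =
  contradiction (trans (sym (length-gaps lk)) (cong₂ (λ E O → length E + length O) E≡[] O≡[])) (>⇒≢ 1≤b)

gapless-gaps-injective : ∀ {l l′} → Partition l → Partition l′ → evenGaps l ≡ [] → oddGaps l ≡ [] →
                         evenGaps l ≡ evenGaps l′ → oddGaps l ≡ oddGaps l′ → topGap l ≡ topGap l′ → l ≡ l′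
gapless-gaps-injective {l} {l′} pl pl′ E≡[] O≡[] eE eO eT = begin
  l                  ≡⟨ gapless⇒oneRow pl E≡[] O≡[] ⟩
  oneRow (topGap l)  ≡⟨ cong oneRow eT ⟩
  oneRow (topGap l′) ≡⟨ sym (gapless⇒oneRow pl′ (trans (sym eE) E≡[]) (trans (sym eO) O≡[])) ⟩
  l′                 ∎
  where open ≡-Reasoning

gaps-injective : ∀ {l l′} → Partition l → Partition l′ →
                 evenGaps l ≡ evenGaps l′ → oddGaps l ≡ oddGaps l′ → topGap l ≡ topGap l′ → l ≡ l′
gaps-injective {[]}         pl pl′ = gapless-gaps-injective pl pl′ refl refl
gaps-injective {_ ∷ []}     pl pl′ = gapless-gaps-injective pl pl′ refl refl
gaps-injective {_ ∷ _ ∷ _} {[]}     pl pl′ eE eO eT = sym (gapless-gaps-injective pl′ pl refl refl (sym eE) (sym eO) (sym eT))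
gaps-injective {_ ∷ _ ∷ _} {_ ∷ []} pl pl′ eE eO eT = sym (gapless-gaps-injective pl′ pl refl refl (sym eE) (sym eO) (sym eT))
gaps-injective {_ ∷ _ ∷ l} {_ ∷ _ ∷ l′} (_ ∷ _ ∷ ps , a≥b ∷ lk) (_ ∷ _ ∷ ps′ , a′≥b′ ∷ lk′) eE eO eT
  with E≡ , x≡ ← addColumn-injective (proj₁ (evenGaps-partition l)) (proj₁ (evenGaps-partition l′)) eE
     | O≡ , t≡ ← addColumn-injective (proj₁ (oddGaps-partition l)) (proj₁ (oddGaps-partition l′)) eO
  with refl ← gaps-injective (ps , Linked.tail lk) (ps′ , Linked.tail lk′) E≡ O≡ t≡
  with refl ← ∸-cancelʳ-≡ (largestPart-tail≤ lk) (largestPart-tail≤ lk′) x≡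
  with refl ← ∸-cancelʳ-≡ a≥b a′≥b′ eT
  = refl

GapPreimage : List ℕ → List ℕ → ℕ → Set
GapPreimage α β r = ∃[ l ] Partition l × evenGaps l ≡ α × oddGaps l ≡ β × topGap l ≡ r

-- Induction on a bound m for the parts of α and β, which removing their first columns decreases.
gaps-surjective : ∀ m {α β} r → Partition α → Partition β →
                  largestPart α ≤ m → largestPart β ≤ m → GapPreimage α β r
stackTwoRows : ∀ m {α β} r → Partition α → Partition β → 1 ≤ length α + length β →
               largestPart α ≤ suc m → largestPart β ≤ suc m → GapPreimage α β r

gaps-surjective _ {[]} {[]} zero    _ _ _ _ = [] , ([] , []) , refl , refl , refl
gaps-surjective _ {[]} {[]} (suc r) _ _ _ _ = suc r ∷ [] , (s≤s z≤n ∷ [] , [-]) , refl , refl , refl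
gaps-surjective zero {_ ∷ _}         _ (1≤a ∷ _ , _) _ a≤0 _ = contradiction a≤0 (<⇒≱ 1≤a)
gaps-surjective zero {[]} {_ ∷ _}    _ _ (1≤b ∷ _ , _) _ b≤0 = contradiction b≤0 (<⇒≱ 1≤b)
gaps-surjective (suc m) {_ ∷ _}      r pα pβ = stackTwoRows m r pα pβ (s≤s z≤n)
gaps-surjective (suc m) {[]} {_ ∷ _} r pα pβ = stackTwoRows m r pα pβ (s≤s z≤n)

stackTwoRows m {α} {β} r pα pβ nonempty α≤ β≤
  with α′ , x , pα′ , α′≤ , refl ← removeColumn α pα
     | β′ , y , pβ′ , β′≤ , refl ← removeColumn β pβ
  with l , pl , refl , refl , refl ←
         gaps-surjective m y pα′ pβ′ (≤-trans α′≤ (pred-mono-≤ α≤)) (≤-trans β′≤ (pred-mono-≤ β≤))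
  = r + b ∷ b ∷ l , (≤-trans 1≤b (m≤n+m b r) ∷ 1≤b ∷ proj₁ pl , linked) , evenGaps≡ , refl , m+n∸n≡m r b
  where
  b = x + largestPart l
  linked : Linked _≥_ (r + b ∷ b ∷ l)
  linked = m≤n+m b r ∷ linked-∷ (m≤n+m (largestPart l) x) (proj₂ pl)
  evenGaps≡ : evenGaps (r + b ∷ b ∷ l) ≡ addColumn (evenGaps l) x
  evenGaps≡ = cong (addColumn (evenGaps l)) (m+n∸n≡m x (largestPart l))
  1≤b : 1 ≤ b
  1≤b = subst (1 ≤_) (trans (cong (λ μ → length μ + _) (sym evenGaps≡)) (length-gaps linked)) nonempty

listsOf-length : ∀ k m {l} → l ∈ listsOf k m → length l ≡ k
listsOf-length zero    m (here refl) = refl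
listsOf-length (suc k) m l∈
  with a , _ , l∈′ ← ∈-concatMap⁻′ (λ a → map (a ∷_) (listsOf k m)) (upTo (suc m)) l∈
  with _ , l′∈ , refl ← ∈-map⁻ (a ∷_) l∈′
  = cong suc (listsOf-length k m l′∈)

∈-listsOf : ∀ m {l} → All (_≤ m) l → l ∈ listsOf (length l) m
∈-listsOf m []                  = here refl
∈-listsOf m {a ∷ l} (a≤m ∷ l≤m) =
  ∈-concatMap⁺′ (λ a → map (a ∷_) (listsOf (length l) m)) (∈-upTo⁺ (s≤s a≤m)) (∈-map⁺ (a ∷_) (∈-listsOf m l≤m))

listsOf-unique : ∀ k m → Unique (listsOf k m)
listsOf-unique zero    m = [] ∷ []
listsOf-unique (suc k) m =
  concatMap-unique (λ a → map (a ∷_) (listsOf k m)) (upTo⁺ (suc m))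
    (λ _ → map⁺ ∷-injectiveʳ (listsOf-unique k m)) sameHead
  where
  sameHead : ∀ {a a′ l} → l ∈ map (a ∷_) (listsOf k m) → l ∈ map (a′ ∷_) (listsOf k m) → a ≡ a′
  sameHead l∈ l∈′ with _ , _ , refl ← ∈-map⁻ _ l∈ | _ , _ , refl ← ∈-map⁻ _ l∈′ = refl

partitions-unique : ∀ n → Unique (partitions n)
partitions-unique n = filter⁺ (isPartition? n)
  (concatMap-unique (λ k → listsOf k n) (upTo⁺ (suc n)) (λ k → listsOf-unique k n)
    (λ l∈ l∈′ → trans (sym (listsOf-length _ n l∈)) (listsOf-length _ n l∈′)))

∈-partitions⁺ : ∀ {n l} → IsPartition n l → l ∈ partitions n
∈-partitions⁺ {l = l} l⊢n@(refl , ps , _) =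
  ∈-filter⁺ (isPartition? (sum l))
    (∈-concatMap⁺′ (λ k → listsOf k (sum l)) (∈-upTo⁺ (s≤s (length≤sum ps))) (∈-listsOf (sum l) (parts≤sum l)))
    l⊢n

∈-partitions⁻ : ∀ {n l} → l ∈ partitions n → IsPartition n l
∈-partitions⁻ {n} l∈ = proj₂ (∈-filter⁻ (isPartition? n) {xs = candidates n} l∈)

partitionPairsAt : ℕ → ℕ → List (List ℕ × List ℕ)
partitionPairsAt j i = cartesianProduct (partitions i) (partitions (j ∸ i))

partitionPairs : ℕ → List (List ℕ × List ℕ)
partitionPairs j = concatMap (partitionPairsAt j) (upTo (suc j))

length-partitionPairs : ∀ j → length (partitionPairs j) ≡ conv j
length-partitionPairs j = trans (length-concatMap (partitionPairsAt j) (upTo (suc j)))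
  (cong sum (map-cong (λ i → length-cartesianProduct (partitions i) (partitions (j ∸ i))) (upTo (suc j))))

partitionPairs-unique : ∀ j → Unique (partitionPairs j)
partitionPairs-unique j =
  concatMap-unique (partitionPairsAt j) (upTo⁺ (suc j))
    (λ i → cartesianProduct⁺ (partitions-unique i) (partitions-unique (j ∸ i))) sameWeight
  where
  sameWeight : ∀ {i i′ q} → q ∈ partitionPairsAt j i → q ∈ partitionPairsAt j i′ → i ≡ i′
  sameWeight q∈ q∈′ = trans (sym (proj₁ (∈-partitions⁻ (proj₁ (∈-cartesianProduct⁻ _ _ q∈)))))
                            (proj₁ (∈-partitions⁻ (proj₁ (∈-cartesianProduct⁻ _ _ q∈′))))

∈-partitionPairs⁺ : ∀ {α β} → Partition α → Partition β → (α , β) ∈ partitionPairs (sum α + sum β)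
∈-partitionPairs⁺ {α} {β} pα pβ =
  ∈-concatMap⁺′ (partitionPairsAt (sum α + sum β)) (∈-upTo⁺ (s≤s (m≤m+n (sum α) (sum β))))
    (∈-cartesianProduct⁺ (∈-partitions⁺ (refl , pα)) (∈-partitions⁺ (sym (m+n∸m≡n (sum α) (sum β)) , pβ)))

∈-partitionPairs⁻ : ∀ {j α β} → (α , β) ∈ partitionPairs j → Partition α × Partition β × sum α + sum β ≡ j
∈-partitionPairs⁻ {j} {α} q∈
  with i , i∈ , q∈′ ← ∈-concatMap⁻′ (partitionPairsAt j) (upTo (suc j)) q∈
  with α∈ , β∈ ← ∈-cartesianProduct⁻ (partitions i) _ q∈′
  with refl , pα ← ∈-partitions⁻ {i} α∈
  with sβ , pβ ← ∈-partitions⁻ {j ∸ i} β∈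
  = pα , pβ , trans (cong (sum α +_) sβ) (m+[n∸m]≡n (s≤s⁻¹ (∈-upTo⁻ i∈)))

partitionsWithEvenSum : ℕ → ℕ → List (List ℕ)
partitionsWithEvenSum n j = filter (λ l → evenSum l ≟ j) (partitions n)

∈-partitionsWithEvenSum⁻ : ∀ {n j l} → l ∈ partitionsWithEvenSum n j → IsPartition n l × evenSum l ≡ j
∈-partitionsWithEvenSum⁻ {n} {j} l∈
  with l∈′ , e ← ∈-filter⁻ (λ l → evenSum l ≟ j) {xs = partitions n} l∈
  = ∈-partitions⁻ l∈′ , e

Fits : ℕ → ℕ → List ℕ × List ℕ → Set
Fits n j (_ , β) = minimalSize j β ≤ n

fits? : ∀ n j → Decidable (Fits n j)
fits? n j (_ , β) = minimalSize j β ≤? n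

gapPartitions-fit : ∀ {n j l} → l ∈ partitionsWithEvenSum n j → gapPartitions l ∈ filter (fits? n j) (partitionPairs j)
gapPartitions-fit {n} {j} {l} l∈
  with (refl , _ , lk) , refl ← ∈-partitionsWithEvenSum⁻ {n} {j} l∈
  = ∈-filter⁺ (fits? (sum l) (evenSum l))
      (subst (λ j → gapPartitions l ∈ partitionPairs j) (sum-gaps lk)
        (∈-partitionPairs⁺ (evenGaps-partition l) (oddGaps-partition l)))
      (≤-trans (m≤m+n _ (topGap l)) (≤-reflexive (sym (sum-via-gaps lk))))

fitting⇒gapPartitions : ∀ {n j q} → q ∈ filter (fits? n j) (partitionPairs j) →
                        ∃[ l ] l ∈ partitionsWithEvenSum n j × gapPartitions l ≡ q
fitting⇒gapPartitions {n} {j} {α , β} q∈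
  with q∈pairs , fits ← ∈-filter⁻ (fits? n j) {xs = partitionPairs j} q∈
  with pα , pβ , refl ← ∈-partitionPairs⁻ {j} q∈pairs
  with l , (ps , lk) , refl , refl , t≡ ← gaps-surjective (largestPart α + largestPart β) (n ∸ minimalSize j β) pα pβ
                                            (m≤m+n _ _) (m≤n+m _ _)
  = l , ∈-filter⁺ (λ l → evenSum l ≟ j) (∈-partitions⁺ (sum≡n , ps , lk)) (sym (sum-gaps lk)) , refl
  where
  sum≡n : sum l ≡ n
  sum≡n = begin
    sum l                                               ≡⟨ sum-via-gaps lk ⟩
    minimalSize (evenSum l) (oddGaps l) + topGap l       ≡⟨ cong₂ (λ e t → minimalSize e (oddGaps l) + t) (sym (sum-gaps lk)) t≡ ⟩
    minimalSize j (oddGaps l) + (n ∸ minimalSize j β)   ≡⟨ m+[n∸m]≡n fits ⟩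
    n                                                   ∎
    where open ≡-Reasoning

size-via-gaps : ∀ {n j l} → l ∈ partitionsWithEvenSum n j → minimalSize j (oddGaps l) + topGap l ≡ n
size-via-gaps {n} {j} l∈
  with (refl , _ , lk) , refl ← ∈-partitionsWithEvenSum⁻ {n} {j} l∈
  = sym (sum-via-gaps lk)

gapPartitions-injective : ∀ {n j l l′} → l ∈ partitionsWithEvenSum n j → l′ ∈ partitionsWithEvenSum n j →
                          gapPartitions l ≡ gapPartitions l′ → l ≡ l′
gapPartitions-injective {n} {j} {l} {l′} l∈ l′∈ gaps≡ =
  gaps-injective (proj₂ (proj₁ (∈-partitionsWithEvenSum⁻ {n} {j} l∈)))
                 (proj₂ (proj₁ (∈-partitionsWithEvenSum⁻ {n} {j} l′∈)))
    E≡ O≡ (+-cancelˡ-≡ (minimalSize j (oddGaps l)) _ _ sizes≡)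
  where
  open ≡-Reasoning
  E≡ = cong proj₁ gaps≡
  O≡ = cong proj₂ gaps≡
  sizes≡ : minimalSize j (oddGaps l) + topGap l ≡ minimalSize j (oddGaps l) + topGap l′
  sizes≡ = begin
    minimalSize j (oddGaps l) + topGap l   ≡⟨ size-via-gaps l∈ ⟩
    n                                      ≡⟨ sym (size-via-gaps l′∈) ⟩
    minimalSize j (oddGaps l′) + topGap l′ ≡⟨ cong (λ β → minimalSize j β + topGap l′) (sym O≡) ⟩
    minimalSize j (oddGaps l) + topGap l′  ∎

f≡length-fitting : ∀ n j → f n j ≡ length (filter (fits? n j) (partitionPairs j))
f≡length-fitting n j = begin
  f n j                                                 ≡⟨ sym (length-map gapPartitions (partitionsWithEvenSum n j)) ⟩
  length (map gapPartitions (partitionsWithEvenSum n j)) ≡⟨ length-unique-set images! fitting! (mk⇔ to from) ⟩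
  length (filter (fits? n j) (partitionPairs j))        ∎
  where
  open ≡-Reasoning
  images! = map-unique gapPartitions (gapPartitions-injective {n} {j}) (filter⁺ (λ l → evenSum l ≟ j) (partitions-unique n))
  fitting! = filter⁺ (fits? n j) (partitionPairs-unique j)
  to : ∀ {q} → q ∈ map gapPartitions (partitionsWithEvenSum n j) → q ∈ filter (fits? n j) (partitionPairs j)
  to q∈ with l , l∈ , refl ← ∈-map⁻ gapPartitions q∈ = gapPartitions-fit {n} {j} l∈
  from : ∀ {q} → q ∈ filter (fits? n j) (partitionPairs j) → q ∈ map gapPartitions (partitionsWithEvenSum n j)
  from q∈ with l , l∈ , refl ← fitting⇒gapPartitions {n} {j} q∈ = ∈-map⁺ gapPartitions l∈

3*j≤n⇒Fits : ∀ {n j q} → 3 * j ≤ n → q ∈ partitionPairs j → Fits n j q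
3*j≤n⇒Fits {n} {j} {α , β} 3j≤n q∈
  with _ , (β⁺ , _) , refl ← ∈-partitionPairs⁻ {j} q∈
  = ≤-trans (+-monoʳ-≤ j (+-monoʳ-≤ j ℓβ≤j)) 3j≤n
  where
  ℓβ≤j : length β ≤ j + 0
  ℓβ≤j = ≤-trans (length≤sum β⁺) (≤-trans (m≤n+m (sum β) (sum α)) (m≤m+n j 0))

ones∈partitionPairs : ∀ j → ([] , ones j) ∈ partitionPairs j
ones∈partitionPairs j =
  subst (λ k → ([] , ones j) ∈ partitionPairs k) (sum-ones j) (∈-partitionPairs⁺ ([] , []) (ones-partition j))

n<3*j⇒¬Fits-ones : ∀ {n j} → n < 3 * j → ¬ Fits n j ([] , ones j)
n<3*j⇒¬Fits-ones {n} {j} n<3j fits =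
  <⇒≱ n<3j (subst (_≤ n) (cong (λ k → j + (j + k)) (trans (length-replicate j) (sym (+-identityʳ j)))) fits)

theorem1 : (n j : ℕ) → (3 * j ≤ n → f n j ≡ conv j) × (n < 3 * j → f n j < conv j)
theorem1 n j = equality , strict
  where
  open ≡-Reasoning
  equality : 3 * j ≤ n → f n j ≡ conv j
  equality 3j≤n = begin
    f n j                                          ≡⟨ f≡length-fitting n j ⟩
    length (filter (fits? n j) (partitionPairs j)) ≡⟨ cong length (filter-all (fits? n j) (All.tabulate (3*j≤n⇒Fits {n} {j} 3j≤n))) ⟩
    length (partitionPairs j)                      ≡⟨ length-partitionPairs j ⟩
    conv j                                         ∎
  strict : n < 3 * j → f n j < conv j
  strict n<3j = subst₂ _<_ (sym (f≡length-fitting n j)) (length-partitionPairs j)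
    (filter-notAll (fits? n j) (partitionPairs j) (lose (ones∈partitionPairs j) (n<3*j⇒¬Fits-ones {n} {j} n<3j)))
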